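{- Let $\lambda\supseteq\mu$ be partitions and let $T_0$ be a reverse plane partition of shape $\lambda/\mu$. Then \[ \sum_{T\in\mathrm{MRPP}(T_0)}\mathrm{wt}_L(T)=\sum_{T\in\mathrm{RMRPP}(T_0)}\mathrm{wt}_R(T). \]
   Context: Indeterminates $x=(x_i)$, $\alpha=(\alpha_i)$, $\beta=(\beta_i)$. The skew shape $\lambda/\mu$ is the set of cells $(i,j)$ (row $i$, column $j$) with $\mu_i<j\le\lambda_i$. A reverse plane partition of shape $\lambda/\mu$ is a filling of these cells with positive integers weakly increasing along rows and columns. Below, an equality $T(i,j)=T(i',j')$ refers to underlying integers and is considered false if $(i',j')$ is not a cell of $\lambda/\mu$. A left-marked RPP is a reverse plane partition in which each entry $T(i,j)$ with $T(i,j)=T(i,j+1)$ may be marked; $\mathrm{MRPP}(T_0)$ is the set of left-marked RPPs with underlying RPP $T_0$, and $\mathrm{wt}_L(T)=\prod_{(i,j)}w_L(i,j)$ with $w_L(i,j)=-\alpha_j$ if $T(i,j)$ is marked, $\beta_{i-1}$ if unmarked and $T(i,j)=T(i-1,j)$, and $x_{T(i,j)}$ otherwise. A right-marked RPP is a reverse plane partition in which each entry $T(i,j)$ with $T(i,j)=T(i,j-1)$ may be marked; $\mathrm{RMRPP}(T_0)$ is the set of right-marked RPPs with underlying RPP $T_0$, and $\mathrm{wt}_R(T)=\prod_{(i,j)}w_R(i,j)$ with $w_R(i,j)=-\alpha_{j-1}$ if $T(i,j)$ is marked, $\beta_i$ if unmarked and $T(i,j)=T(i+1,j)$, and $x_{T(i,j)}$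 otherwise. -}

module Defs where

open import Level using (Level)
open import Data.Bool using (Bool; true; false; if_then_else_; _∧_; T)
open import Data.Nat using (ℕ; zero; suc; _+_; _∸_; _≤_; _<_; _≡ᵇ_; _<ᵇ_; _≤ᵇ_)
open import Data.List using (List; []; _∷_; [_]; map; _++_; concatMap; upTo; length)
open import Data.List.Relation.Unary.Linked using (Linked)
open import Data.Product using (_×_; _,_)
open import Algebra.Bundles using (CommutativeRing)

-- A partition is a weakly decreasing list of natural numbers
-- (trailing zeros are allowed and harmless).
IsPartition : List ℕ → Set
IsPartition = Linked (λ a b → b ≤ a)

-- part p i = p_i, 1-indexed; 0 outside the list.
part : List ℕ → ℕ → ℕ
part []       _             = 0
part (_ ∷ _)  zero          = 0
part (a ∷ _)  (suc zero)    = a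
part (_ ∷ p)  (suc (suc i)) = part p (suc i)

_⊆ₚ_ : List ℕ → List ℕ → Set
μ ⊆ₚ λ' = ∀ i → part μ i ≤ part λ' i

-- cells are (row i, column j), 1-indexed
Cell : Set
Cell = ℕ × ℕ

inShape : List ℕ → List ℕ → ℕ → ℕ → Bool
inShape λ' μ i j = (0 <ᵇ i) ∧ ((part μ i <ᵇ j) ∧ (j ≤ᵇ part λ' i))

InShape : List ℕ → List ℕ → ℕ → ℕ → Set
InShape λ' μ i j = T (inShape λ' μ i j)

-- Fillings are functions ℕ → ℕ → ℕ; only values on cells of λ/μ matter.
Filling : Set
Filling = ℕ → ℕ → ℕ

IsRPP : List ℕ → List ℕ → Filling → Set
IsRPP λ' μ F =
  ∀ i j → InShape λ' μ i j →
    (1 ≤ F i j)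
    × (InShape λ' μ i (suc j) → F i j ≤ F i (suc j))
    × (InShape λ' μ (suc i) j → F i j ≤ F (suc i) j)

cells : List ℕ → List ℕ → List Cell
cells λ' μ =
  concatMap (λ i → map (λ k → (i , suc (part μ i + k)))
                       (upTo (part λ' i ∸ part μ i)))
            (map suc (upTo (length λ')))

eqAt : List ℕ → List ℕ → Filling → ℕ → ℕ → ℕ → ℕ → Bool
eqAt λ' μ F i j i' j' = inShape λ' μ i' j' ∧ (F i j ≡ᵇ F i' j')

-- All markings of a list of cells: each cell gets a Bool (true = marked),
-- a cell may be marked only if it is markable.
markings : (Cell → Bool) → List Cell → List (List (Cell × Bool))
markings m [] = [ [] ]
markings m (c ∷ cs) =
  if m c
  then map ((c , false) ∷_) rest ++ map ((c , true) ∷_) rest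
  else map ((c , false) ∷_) rest
  where rest = markings m cs

leftMarkable : List ℕ → List ℕ → Filling → Cell → Bool
leftMarkable λ' μ F (i , j) = eqAt λ' μ F i j i (suc j)

rightMarkable : List ℕ → List ℕ → Filling → Cell → Bool
rightMarkable λ' μ F (i , j) = eqAt λ' μ F i j i (j ∸ 1)

MRPP : List ℕ → List ℕ → Filling → List (List (Cell × Bool))
MRPP λ' μ F = markings (leftMarkable λ' μ F) (cells λ' μ)

RMRPP : List ℕ → List ℕ → Filling → List (List (Cell × Bool))
RMRPP λ' μ F = markings (rightMarkable λ' μ F) (cells λ' μ)

module Weights {c ℓ : Level} (R : CommutativeRing c ℓ) where
  open CommutativeRing R using (Carrier; 0#; 1#; -_) renaming (_+_ to _+R_; _*_ to _*R_)

  prodL : List Carrier → Carrier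
  prodL [] = 1#
  prodL (a ∷ as) = a *R prodL as

  sumL : List Carrier → Carrier
  sumL [] = 0#
  sumL (a ∷ as) = a +R sumL as

  module _ (x α β : ℕ → Carrier) (λ' μ : List ℕ) (F : Filling) where

    wL : Cell × Bool → Carrier
    wL ((i , j) , true)  = - (α j)
    wL ((i , j) , false) =
      if eqAt λ' μ F i j (i ∸ 1) j then β (i ∸ 1) else x (F i j)

    wR : Cell × Bool → Carrier
    wR ((i , j) , true)  = - (α (j ∸ 1))
    wR ((i , j) , false) =
      if eqAt λ' μ F i j (suc i) j then β i else x (F i j)

    wtL : List (Cell × Bool) → Carrier
    wtL ms = prodL (map wL ms)

    wtR : List (Cell × Bool) → Carrier
    wtR ms = prodL (map wR ms)

    sumMRPP : Carrier
    sumMRPP = sumL (map wtL (MRPP λ' μ F))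

    sumRMRPP : Carrier
    sumRMRPP = sumL (map wtR (RMRPP λ' μ F))

{-# OPTIONS --safe #-}
module Submission where

-- Summing over the markings cell by cell turns each side into a product, over the cells of
-- λ/μ, of "unmarked weight − α if markable". Let row₀ t be the right-hand product over row t
-- with every β replaced by x. For adjacent rows t, t+1 the β_t-factors of the left weights of
-- row t+1 and of the right weights of row t come from the same vertical equalities, and
--   row₀ t · (left weights of row t+1) = (right weights of row t) · row₀ (t+1);
-- this is shown by sweeping the columns from left to right, carrying the factor of a
-- left-marked bottom cell to the next column, where its right-marked partner has the same α.
-- Each step rests on the fact that in a 2×2 square of a reverse plane partition the entries
-- along one monotone path from the top-left to the bottom-right corner are all equal iff they
-- are along the other. Telescoping over the rows proves the identity, as row 0 and the row
-- below the last one are empty.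

open import Defs
open import Level using (Level)
open import Algebra.Bundles using (CommutativeRing)
open import Data.Bool using (Bool; true; false; if_then_else_; _∧_; T)
open import Data.Bool.Properties using (T-∧; ∧-zeroʳ)
open import Data.Empty using (⊥-elim)
open import Data.List using (List; []; _∷_; _++_; map; applyUpTo; upTo; concatMap; length)
open import Data.List.Properties using (map-∘)
open import Data.List.Relation.Unary.Linked using ([]; [-]; _∷_)
open import Data.Nat using (ℕ; zero; suc; _∸_; _≡ᵇ_; _≤_; _<_; z≤n)
import Data.Nat as ℕ
import Data.Nat.Properties as ℕₚ
open import Data.Nat.ListAction using (sum)
open import Data.Product using (∃; _×_; _,_; proj₁; proj₂)
open import Function using (_∘_; id; Equivalence)
open import Relation.Nullary using (¬_)
open import Relation.Binary.PropositionalEquality as ≡ using (_≡_)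

open Equivalence using (to; from)

module RingProducts {c ℓ : Level} (R : CommutativeRing c ℓ) where
  open CommutativeRing R
  open import Algebra.Properties.CommutativeSemigroup *-commutativeSemigroup
  open import Relation.Binary.Reasoning.Setoid setoid
  open Weights R using (prodL; sumL)

  when : Bool → Carrier → Carrier
  when b u = if b then u else 1#

  _⊖⟨_⟩_ : Carrier → Bool → Carrier → Carrier
  u ⊖⟨ b ⟩ a = if b then u - a else u

  when-cong : ∀ b {u v} → (T b → u ≈ v) → when b u ≈ when b v
  when-cong true  u≈v = u≈v _
  when-cong false _   = refl

  when-T : ∀ b {u} → T b → when b u ≈ u
  when-T true _ = refl

  when-¬T : ∀ b {u} → ¬ T b → when b u ≈ 1#
  when-¬T true  ¬b = ⊥-elim (¬b _)
  when-¬T false _  = refl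

  +-if≈⊖ : ∀ u b a → u + (if b then - a else 0#) ≈ u ⊖⟨ b ⟩ a
  +-if≈⊖ u true  a = refl
  +-if≈⊖ u false a = +-identityʳ u

  prod : ℕ → (ℕ → Carrier) → Carrier
  prod zero    f = 1#
  prod (suc n) f = prod n f * f n

  syntax prod n (λ k → e) = ∏[ k < n ] e

  prod-cong : ∀ n {f g} → (∀ k → k < n → f k ≈ g k) → prod n f ≈ prod n g
  prod-cong zero    f≈g = refl
  prod-cong (suc n) f≈g =
    *-cong (prod-cong n (λ k k<n → f≈g k (ℕₚ.m<n⇒m<1+n k<n))) (f≈g n ℕₚ.≤-refl)

  prod-trivial : ∀ n {f} → (∀ k → k < n → f k ≈ 1#) → prod n f ≈ 1#
  prod-trivial zero    f≈1 = refl
  prod-trivial (suc n) f≈1 =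
    trans (*-cong (prod-trivial n (λ k k<n → f≈1 k (ℕₚ.m<n⇒m<1+n k<n))) (f≈1 n ℕₚ.≤-refl))
          (*-identityˡ 1#)

  prod-* : ∀ n f g → ∏[ k < n ] (f k * g k) ≈ prod n f * prod n g
  prod-* zero    f g = sym (*-identityˡ 1#)
  prod-* (suc n) f g = trans (*-congʳ (prod-* n f g)) (interchange _ _ _ _)

  prod-suc : ∀ n f → prod (suc n) f ≈ f 0 * ∏[ k < n ] f (suc k)
  prod-suc zero    f = *-comm 1# (f 0)
  prod-suc (suc n) f = trans (*-congʳ (prod-suc n f)) (*-assoc _ _ _)

  prod-+ : ∀ m n f → prod (m ℕ.+ n) f ≈ prod m f * ∏[ k < n ] f (m ℕ.+ k)
  prod-+ zero    n f = sym (*-identityˡ _)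
  prod-+ (suc m) n f = begin
    prod (suc m ℕ.+ n) f                                  ≈⟨ prod-suc (m ℕ.+ n) f ⟩
    f 0 * prod (m ℕ.+ n) (f ∘ suc)                        ≈⟨ *-congˡ (prod-+ m n (f ∘ suc)) ⟩
    f 0 * (prod m (f ∘ suc) * ∏[ k < n ] f (suc m ℕ.+ k)) ≈⟨ *-assoc _ _ _ ⟨
    f 0 * prod m (f ∘ suc) * ∏[ k < n ] f (suc m ℕ.+ k)   ≈⟨ *-congʳ (prod-suc m f) ⟨
    prod (suc m) f * ∏[ k < n ] f (suc m ℕ.+ k)           ∎

  prod-window : ∀ a m n f → a ℕ.+ m ≤ n →
                (∀ k → k < a → f k ≈ 1#) → (∀ k → a ℕ.+ m ≤ k → f k ≈ 1#) →
                prod n f ≈ ∏[ k < m ] f (a ℕ.+ k)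
  prod-window a m n f a+m≤n before after with ℕₚ.m≤n⇒∃[o]m+o≡n a+m≤n
  ... | r , ≡.refl = begin
    prod (a ℕ.+ m ℕ.+ r) f                                      ≈⟨ prod-+ (a ℕ.+ m) r f ⟩
    prod (a ℕ.+ m) f * ∏[ k < r ] f (a ℕ.+ m ℕ.+ k)             ≈⟨ *-congʳ (prod-+ a m f) ⟩
    prod a f * ∏[ k < m ] f (a ℕ.+ k) * ∏[ k < r ] f (a ℕ.+ m ℕ.+ k)
      ≈⟨ *-cong (*-congʳ (prod-trivial a before))
                (prod-trivial r (λ k _ → after _ (ℕₚ.m≤m+n _ k))) ⟩
    1# * ∏[ k < m ] f (a ℕ.+ k) * 1#                             ≈⟨ *-identityʳ _ ⟩
    1# * ∏[ k < m ] f (a ℕ.+ k)                                  ≈⟨ *-identityˡ _ ⟩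
    ∏[ k < m ] f (a ℕ.+ k)                                       ∎

  telescope : ∀ (f g h : ℕ → Carrier) → (∀ t → f t * g t ≈ h t * f (suc t)) →
              ∀ n → f 0 * prod n g ≈ prod n h * f n
  telescope f g h step zero    = *-comm (f 0) 1#
  telescope f g h step (suc n) = begin
    f 0 * (prod n g * g n)     ≈⟨ *-assoc _ _ _ ⟨
    f 0 * prod n g * g n       ≈⟨ *-congʳ (telescope f g h step n) ⟩
    prod n h * f n * g n       ≈⟨ *-assoc _ _ _ ⟩
    prod n h * (f n * g n)     ≈⟨ *-congˡ (step n) ⟩
    prod n h * (h n * f (suc n)) ≈⟨ *-assoc _ _ _ ⟨
    prod n h * h n * f (suc n) ∎

  ⊖-carry : ∀ τ u h a → τ * (u ⊖⟨ h ⟩ a) * when h u ≈ τ * (u * when h (u - a))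
  ⊖-carry τ u true  a = trans (*-assoc _ _ _) (*-congˡ (*-comm (u - a) u))
  ⊖-carry τ u false a = *-assoc _ _ _

  prodL-++ : ∀ {A : Set} (f : A → Carrier) xs ys →
             prodL (map f (xs ++ ys)) ≈ prodL (map f xs) * prodL (map f ys)
  prodL-++ f []       ys = sym (*-identityˡ _)
  prodL-++ f (a ∷ xs) ys = trans (*-congˡ (prodL-++ f xs ys)) (sym (*-assoc _ _ _))

  prodL-concatMap : ∀ {A B : Set} (f : B → Carrier) (g : A → List B) as →
                    prodL (map f (concatMap g as)) ≈ prodL (map (λ a → prodL (map f (g a))) as)
  prodL-concatMap f g []       = refl
  prodL-concatMap f g (a ∷ as) = trans (prodL-++ f (g a) _) (*-congˡ (prodL-concatMap f g as))

  prodL-applyUpTo : ∀ {A : Set} (f : A → Carrier) (g : ℕ → A) n →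
                    prodL (map f (applyUpTo g n)) ≈ ∏[ k < n ] f (g k)
  prodL-applyUpTo f g zero    = refl
  prodL-applyUpTo f g (suc n) =
    trans (*-congˡ (prodL-applyUpTo f (g ∘ suc) n)) (sym (prod-suc n (f ∘ g)))

  sumL-++ : ∀ {A : Set} (f : A → Carrier) xs ys →
            sumL (map f (xs ++ ys)) ≈ sumL (map f xs) + sumL (map f ys)
  sumL-++ f []       ys = sym (+-identityˡ _)
  sumL-++ f (a ∷ xs) ys = trans (+-congˡ (sumL-++ f xs ys)) (sym (+-assoc _ _ _))

  module _ {A : Set} (w : A → Carrier) where

    sumL-prodL-∷ : ∀ a ass → sumL (map (prodL ∘ map w) (map (a ∷_) ass)) ≈
                              w a * sumL (map (prodL ∘ map w) ass)
    sumL-prodL-∷ a []         = sym (zeroʳ _)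
    sumL-prodL-∷ a (as ∷ ass) = trans (+-congˡ (sumL-prodL-∷ a ass)) (sym (distribˡ _ _ _))

  sumL-markings : ∀ (w : Cell × Bool → Carrier) (markable : Cell → Bool) cs →
    sumL (map (prodL ∘ map w) (markings markable cs)) ≈
    prodL (map (λ c → w (c , false) + (if markable c then w (c , true) else 0#)) cs)
  sumL-markings w markable []       = +-identityʳ 1#
  sumL-markings w markable (c ∷ cs) with markable c
  ... | true  = begin
    sumL (map wt (map ((c , false) ∷_) ms ++ map ((c , true) ∷_) ms))
      ≈⟨ sumL-++ wt (map ((c , false) ∷_) ms) _ ⟩
    sumL (map wt (map ((c , false) ∷_) ms)) + sumL (map wt (map ((c , true) ∷_) ms))
      ≈⟨ +-cong (sumL-prodL-∷ w _ ms) (sumL-prodL-∷ w _ ms) ⟩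
    w (c , false) * sumL (map wt ms) + w (c , true) * sumL (map wt ms)
      ≈⟨ distribʳ _ _ _ ⟨
    (w (c , false) + w (c , true)) * sumL (map wt ms)
      ≈⟨ *-congˡ (sumL-markings w markable cs) ⟩
    (w (c , false) + w (c , true)) * prodL (map φ cs) ∎
    where
    wt = prodL ∘ map w
    ms = markings markable cs
    φ = λ c → w (c , false) + (if markable c then w (c , true) else 0#)
  ... | false = begin
    sumL (map wt (map ((c , false) ∷_) ms)) ≈⟨ sumL-prodL-∷ w _ ms ⟩
    w (c , false) * sumL (map wt ms)
      ≈⟨ *-cong (sym (+-identityʳ _)) (sumL-markings w markable cs) ⟩
    (w (c , false) + 0#) * prodL (map φ cs) ∎
    where
    wt = prodL ∘ map w
    ms = markings markable cs
    φ = λ c → w (c , false) + (if markable c then w (c , true) else 0#)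

  CarryStep : (p q l r p′ q′ : Carrier) → Set (c Level.⊔ ℓ)
  CarryStep p q l r p′ q′ = ∃ λ s → l * p′ ≈ p * s × r * q′ ≈ q * s

  carry-sweep : ∀ (l r p q : ℕ → Carrier) → p 0 ≈ q 0 →
                (∀ k → CarryStep (p k) (q k) (l k) (r k) (p (suc k)) (q (suc k))) →
                ∀ n → prod n l * p n ≈ prod n r * q n
  carry-sweep l r p q p₀≈q₀ step zero    = *-congˡ p₀≈q₀
  carry-sweep l r p q p₀≈q₀ step (suc n) with step n
  ... | s , lp≈ps , rq≈qs = begin
    prod n l * l n * p (suc n)   ≈⟨ *-assoc _ _ _ ⟩
    prod n l * (l n * p (suc n)) ≈⟨ *-congˡ lp≈ps ⟩
    prod n l * (p n * s)         ≈⟨ *-assoc _ _ _ ⟨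
    prod n l * p n * s           ≈⟨ *-congʳ (carry-sweep l r p q p₀≈q₀ step n) ⟩
    prod n r * q n * s           ≈⟨ *-assoc _ _ _ ⟩
    prod n r * (q n * s)         ≈⟨ *-congˡ rq≈qs ⟨
    prod n r * (r n * q (suc n)) ≈⟨ *-assoc _ _ _ ⟨
    prod n r * r n * q (suc n)   ∎

  -- Columns j = c - 1 and c of rows t, t + 1: inT, inB say that (t, c), (t + 1, c) are cells;
  -- hT, hB are the links j–c in rows t, t + 1 and hB′ the link c–(c + 1) in row t + 1;
  -- v, v⁻ are the vertical links at c and j; xT, xB, xB⁻ are the x-weights of (t, c),
  -- (t + 1, c), (t + 1, j), and b = β_t, a = α_j, a′ = α_c. On the left the link j–c of row
  -- t + 1 is paid for (by −a) at column j, on the right at column c; the carried factors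
  -- bridge this shift.
  carry-step : ∀ (inT inB hT hB hB′ v v⁻ : Bool) (xT xB xB⁻ b a a′ : Carrier) →
    (T v → T inT × T inB) → (T hB → T inB) → (T hB′ → T inB) →
    (T v → xT ≡ xB) → (T hB → xB⁻ ≡ xB) →
    (T hT → T v → T v⁻ × T hB) → (T v⁻ → T hB → T hT × T v) →
    let u = if v then b else xB
        u⁻ = if v⁻ then b else xB⁻ in
    CarryStep (when hB u⁻) (when hB (u⁻ - a))
              (when inT (xT ⊖⟨ hT ⟩ a) * when inB (u ⊖⟨ hB′ ⟩ a′))
              (when inT ((if v then b else xT) ⊖⟨ hT ⟩ a) * when inB (xB ⊖⟨ hB ⟩ a))
              (when hB′ u) (when hB′ (u - a′))
  carry-step _ false _ true _ _ _ _ _ _ _ _ _ _ hB⇒inB _ _ _ _ _ = ⊥-elim (hB⇒inB _)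
  carry-step _ false _ _ true _ _ _ _ _ _ _ _ _ _ hB′⇒inB _ _ _ _ = ⊥-elim (hB′⇒inB _)
  carry-step _ false _ _ _ true _ _ _ _ _ _ _ v⇒in _ _ _ _ _ _ = ⊥-elim (proj₂ (v⇒in _))
  carry-step _ false _ false false false _ _ _ _ _ _ _ _ _ _ _ _ _ _ =
    _ , sym (*-identityˡ _) , sym (*-identityˡ _)
  carry-step _ true _ false hB′ false _ _ xB _ _ _ a′ _ _ _ _ _ _ _ =
    _ , trans (⊖-carry _ xB hB′ a′) (sym (*-identityˡ _))
      , trans (*-assoc _ _ _) (sym (*-identityˡ _))
  carry-step _ true _ true _ false true _ _ _ _ _ _ _ _ _ _ _ _ squareLB = ⊥-elim (proj₂ (squareLB _ _))
  carry-step _ true _ true hB′ false false _ xB _ _ _ a′ _ _ _ _ hB⇒xB⁻≡xB _ _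
    rewrite hB⇒xB⁻≡xB _ =
    _ , trans (⊖-carry _ xB hB′ a′) (x∙yz≈y∙xz _ _ _) , xy∙z≈y∙xz _ _ _
  carry-step false true _ _ _ true _ _ _ _ _ _ _ v⇒in _ _ _ _ _ _ = ⊥-elim (proj₁ (v⇒in _))
  carry-step true true true false _ true _ _ _ _ _ _ _ _ _ _ _ _ squareTR _ =
    ⊥-elim (proj₂ (squareTR _ _))
  carry-step true true false false hB′ true _ _ xB _ b _ a′ _ _ _ v⇒xT≡xB _ _ _
    rewrite v⇒xT≡xB _ =
    _ , trans (⊖-carry xB b hB′ a′) (trans (x∙yz≈yx∙z _ _ _) (sym (*-identityˡ _)))
      , sym (*-identityˡ _)
  carry-step true true false true _ true true _ _ _ _ _ _ _ _ _ _ _ _ squareLB =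
    ⊥-elim (proj₁ (squareLB _ _))
  carry-step true true true true hB′ true true _ _ _ b _ a′ _ _ _ v⇒xT≡xB _ _ _
    rewrite v⇒xT≡xB _ =
    _ , trans (⊖-carry _ b hB′ a′) (x∙yz≈y∙xz _ _ _) , *-assoc _ _ _
  carry-step true true true true _ true false _ _ _ _ _ _ _ _ _ _ _ squareTR _ =
    ⊥-elim (proj₁ (squareTR _ _))
  carry-step true true false true hB′ true false _ xB _ b _ a′ _ _ _ v⇒xT≡xB hB⇒xB⁻≡xB _ _
    rewrite v⇒xT≡xB _ | hB⇒xB⁻≡xB _ =
    _ , ⊖-carry xB b hB′ a′ , xy∙z≈y∙xz _ _ _

part-suc-≤ : ∀ {p} → IsPartition p → ∀ i → part p (suc (suc i)) ≤ part p (suc i)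
part-suc-≤ []          i       = z≤n
part-suc-≤ [-]         i       = z≤n
part-suc-≤ (a≥b ∷ _)   zero    = a≥b
part-suc-≤ (_ ∷ p)     (suc i) = part-suc-≤ p i

part≤sum : ∀ p i → part p i ≤ sum p
part≤sum []      i             = z≤n
part≤sum (a ∷ p) zero          = z≤n
part≤sum (a ∷ p) (suc zero)    = ℕₚ.m≤m+n a (sum p)
part≤sum (a ∷ p) (suc (suc i)) = ℕₚ.≤-trans (part≤sum p (suc i)) (ℕₚ.m≤n+m (sum p) a)

part-beyond-length : ∀ p → part p (suc (length p)) ≡ 0
part-beyond-length []      = ≡.refl
part-beyond-length (_ ∷ p) = part-beyond-length p

squeeze : ∀ {a b c} → a ≤ b → b ≤ c → a ≡ c → a ≡ b
squeeze a≤b b≤c ≡.refl = ℕₚ.≤-antisym a≤b b≤c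

≡ᵇ-sym : ∀ m n → (m ≡ᵇ n) ≡ (n ≡ᵇ m)
≡ᵇ-sym zero    zero    = ≡.refl
≡ᵇ-sym zero    (suc n) = ≡.refl
≡ᵇ-sym (suc m) zero    = ≡.refl
≡ᵇ-sym (suc m) (suc n) = ≡ᵇ-sym m n

module Links (λ' μ : List ℕ) (F : Filling) where

  isCell : ℕ → ℕ → Bool
  isCell = inShape λ' μ

  linked : ℕ → ℕ → ℕ → ℕ → Bool
  linked i j i′ j′ = isCell i j ∧ eqAt λ' μ F i j i′ j′

  hLink vLink : ℕ → ℕ → Bool
  hLink i j = linked i j i (suc j)
  vLink i j = linked i j (suc i) j

  isCell⇒ : ∀ {i j} → T (isCell i j) → 0 < i × part μ i < j × j ≤ part λ' i
  isCell⇒ {i} {j} p =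
    let 0<i , rest = to T-∧ p
        μ<j , j≤λ  = to (T-∧ {part μ i ℕ.<ᵇ j}) rest
    in ℕₚ.<ᵇ⇒< 0 i 0<i , ℕₚ.<ᵇ⇒< _ _ μ<j , ℕₚ.≤ᵇ⇒≤ _ _ j≤λ

  ⇒isCell : ∀ {i j} → 0 < i → part μ i < j → j ≤ part λ' i → T (isCell i j)
  ⇒isCell 0<i μ<j j≤λ =
    from T-∧ (ℕₚ.<⇒<ᵇ 0<i , from T-∧ (ℕₚ.<⇒<ᵇ μ<j , ℕₚ.≤⇒≤ᵇ j≤λ))

  linked⇒ : ∀ {i j i′ j′} → T (linked i j i′ j′) →
            T (isCell i j) × T (isCell i′ j′) × F i j ≡ F i′ j′
  linked⇒ {i} {j} {i′} {j′} p =
    let ij , rest = to (T-∧ {isCell i j}) p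
        i′j′ , eq = to (T-∧ {isCell i′ j′}) rest
    in ij , i′j′ , ℕₚ.≡ᵇ⇒≡ _ _ eq

  ⇒linked : ∀ {i j i′ j′} → T (isCell i j) → T (isCell i′ j′) → F i j ≡ F i′ j′ →
            T (linked i j i′ j′)
  ⇒linked ij i′j′ eq = from T-∧ (ij , from T-∧ (i′j′ , ℕₚ.≡⇒≡ᵇ _ _ eq))

  eqAt≡linked : ∀ {i j} i′ j′ → T (isCell i j) →
                eqAt λ' μ F i j i′ j′ ≡ linked i j i′ j′
  eqAt≡linked {i} {j} i′ j′ ij with isCell i j
  ... | true = ≡.refl

  linked-sym : ∀ i j i′ j′ → linked i j i′ j′ ≡ linked i′ j′ i j
  linked-sym i j i′ j′ with isCell i j | isCell i′ j′
  ... | true  | true  = ≡ᵇ-sym (F i j) (F i′ j′)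
  ... | true  | false = ≡.refl
  ... | false | true  = ≡.refl
  ... | false | false = ≡.refl

module Squares (λ' μ : List ℕ) (pλ : IsPartition λ') (pμ : IsPartition μ)
               (F : Filling) (rpp : IsRPP λ' μ F) where
  open Links λ' μ F

  square-cells : ∀ {t k} → T (isCell t k) → T (isCell (suc t) (suc k)) →
                 T (isCell (suc t) k) × T (isCell t (suc k))
  square-cells {suc t} tk bk′ with isCell⇒ tk | isCell⇒ bk′
  ... | 0<t , μₜ<k , _ | _ , _ , k<λᵦ =
    ⇒isCell ℕ.z<s (ℕₚ.≤-<-trans (part-suc-≤ pμ t) μₜ<k) (ℕₚ.<⇒≤ k<λᵦ) ,
    ⇒isCell 0<t (ℕₚ.m<n⇒m<1+n μₜ<k) (ℕₚ.≤-trans k<λᵦ (part-suc-≤ pλ t))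

  F-mono-right : ∀ {i j} → T (isCell i j) → T (isCell i (suc j)) → F i j ≤ F i (suc j)
  F-mono-right ij ij′ = proj₁ (proj₂ (rpp _ _ ij)) ij′

  F-mono-down : ∀ {i j} → T (isCell i j) → T (isCell (suc i) j) → F i j ≤ F (suc i) j
  F-mono-down ij i′j = proj₂ (proj₂ (rpp _ _ ij)) i′j

  square-top-right : ∀ t k → T (hLink t k) → T (vLink t (suc k)) →
                     T (vLink t k) × T (hLink (suc t) k)
  square-top-right t k h v with linked⇒ {t} {k} h | linked⇒ {t} {suc k} v
  ... | tk , _ , e₁ | _ , bk′ , e₂ =
    ⇒linked tk bk e , ⇒linked bk bk′ (≡.trans (≡.sym e) (≡.trans e₁ e₂))
    where
    bk = proj₁ (square-cells tk bk′)
    e = squeeze (F-mono-down tk bk) (F-mono-right bk bk′) (≡.trans e₁ e₂)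

  square-left-bottom : ∀ t k → T (vLink t k) → T (hLink (suc t) k) →
                       T (hLink t k) × T (vLink t (suc k))
  square-left-bottom t k v h with linked⇒ {t} {k} v | linked⇒ {suc t} {k} h
  ... | tk , _ , e₁ | _ , bk′ , e₂ =
    ⇒linked tk tk′ e , ⇒linked tk′ bk′ (≡.trans (≡.sym e) (≡.trans e₁ e₂))
    where
    tk′ = proj₂ (square-cells tk bk′)
    e = squeeze (F-mono-right tk tk′) (F-mono-down tk′ bk′) (≡.trans e₁ e₂)

module Tableau {ℓ₁ ℓ₂ : Level} (R : CommutativeRing ℓ₁ ℓ₂)
               (x α β : ℕ → CommutativeRing.Carrier R)
               (λ' μ : List ℕ) (pλ : IsPartition λ') (pμ : IsPartition μ) (μ⊆λ : μ ⊆ₚ λ')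
               (F : Filling) (rpp : IsRPP λ' μ F) where
  open CommutativeRing R
  open RingProducts R
  open Weights R
  open Links λ' μ F
  open Squares λ' μ pλ pμ F rpp
  open import Relation.Binary.Reasoning.Setoid setoid

  -- Any bound on the row lengths would do; column suc k of the diagram is indexed by k < width.
  width : ℕ
  width = sum λ'

  isCell-beyond-width : ∀ i → ¬ T (isCell i (suc width))
  isCell-beyond-width i p = ℕₚ.<⇒≱ (proj₂ (proj₂ (isCell⇒ p))) (part≤sum λ' i)

  isCell-below-last : ∀ j → isCell (suc (length λ')) (suc j) ≡ false
  isCell-below-last j rewrite part-beyond-length λ' = ∧-zeroʳ _

  rowCells : ℕ → List Cell
  rowCells i = map (λ k → (i , suc (part μ i ℕ.+ k))) (upTo (part λ' i ∸ part μ i))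

  prodL-rowCells : ∀ (φ : Cell → Carrier) i → 0 < i →
    prodL (map φ (rowCells i)) ≈ ∏[ k < width ] when (isCell i (suc k)) (φ (i , suc k))
  prodL-rowCells φ i 0<i = begin
    prodL (map φ (rowCells i))        ≡⟨ ≡.cong prodL (map-∘ (upTo m)) ⟨
    prodL (map (φ ∘ cellAt) (upTo m)) ≈⟨ prodL-applyUpTo (φ ∘ cellAt) id m ⟩
    ∏[ k < m ] φ (cellAt k)           ≈⟨ prod-cong m (λ k k<m → sym (when-T _ (inside k k<m))) ⟩
    ∏[ k < m ] f (a ℕ.+ k)            ≈⟨ prod-window a m width f a+m≤width before after ⟨
    ∏[ k < width ] f k                ∎
    where
    a = part μ i
    m = part λ' i ∸ a
    cellAt = λ k → (i , suc (a ℕ.+ k))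
    f = λ k → when (isCell i (suc k)) (φ (i , suc k))
    a+m≡λᵢ : a ℕ.+ m ≡ part λ' i
    a+m≡λᵢ = ℕₚ.m+[n∸m]≡n (μ⊆λ i)
    a+m≤width : a ℕ.+ m ≤ width
    a+m≤width = ℕₚ.≤-trans (ℕₚ.≤-reflexive a+m≡λᵢ) (part≤sum λ' i)
    inside : ∀ k → k < m → T (isCell i (suc (a ℕ.+ k)))
    inside k k<m = ⇒isCell 0<i (ℕ.s≤s (ℕₚ.m≤m+n a k))
                     (ℕₚ.≤-trans (ℕₚ.+-monoʳ-< a k<m) (ℕₚ.≤-reflexive a+m≡λᵢ))
    before : ∀ k → k < a → f k ≈ 1#
    before k k<a = when-¬T _ (λ p → ℕₚ.<⇒≱ k<a (ℕ.s≤s⁻¹ (proj₁ (proj₂ (isCell⇒ p)))))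
    after : ∀ k → a ℕ.+ m ≤ k → f k ≈ 1#
    after k a+m≤k =
      when-¬T _ (λ p → ℕₚ.<⇒≱ (proj₂ (proj₂ (isCell⇒ p))) (≡.subst (_≤ k) a+m≡λᵢ a+m≤k))

  prodL-cells : ∀ (φ : Cell → Carrier) →
    prodL (map φ (cells λ' μ)) ≈
    ∏[ r < length λ' ] ∏[ k < width ] when (isCell (suc r) (suc k)) (φ (suc r , suc k))
  prodL-cells φ = begin
    prodL (map φ (concatMap rowCells (map suc (upTo n))))
      ≈⟨ prodL-concatMap φ rowCells (map suc (upTo n)) ⟩
    prodL (map (prodL ∘ map φ ∘ rowCells) (map suc (upTo n)))
      ≡⟨ ≡.cong prodL (map-∘ (upTo n)) ⟨
    prodL (map (prodL ∘ map φ ∘ rowCells ∘ suc) (upTo n))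
      ≈⟨ prodL-applyUpTo _ id n ⟩
    ∏[ r < n ] prodL (map φ (rowCells (suc r)))
      ≈⟨ prod-cong n (λ r _ → prodL-rowCells φ (suc r) ℕ.z<s) ⟩
    ∏[ r < n ] ∏[ k < width ] when (isCell (suc r) (suc k)) (φ (suc r , suc k)) ∎
    where n = length λ'

  markingSumL markingSumR : Cell → Carrier
  markingSumL c =
    wL x α β λ' μ F (c , false) + (if leftMarkable λ' μ F c then wL x α β λ' μ F (c , true) else 0#)
  markingSumR c =
    wR x α β λ' μ F (c , false) + (if rightMarkable λ' μ F c then wR x α β λ' μ F (c , true) else 0#)

  factorL : ℕ → ℕ → Carrier
  factorL i j = (if vLink (i ∸ 1) j then β (i ∸ 1) else x (F i j)) ⊖⟨ hLink i j ⟩ α j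

  factorR factor₀ : ℕ → ℕ → Carrier
  factorR i k = (if vLink i (suc k) then β i else x (F i (suc k))) ⊖⟨ hLink i k ⟩ α k
  factor₀ i k = x (F i (suc k)) ⊖⟨ hLink i k ⟩ α k

  markingSumL≈factorL : ∀ i j → T (isCell i j) → markingSumL (i , j) ≈ factorL i j
  markingSumL≈factorL i@(suc t) j ij =
    trans (reflexive (≡.cong₂ factor vertical horizontal)) (+-if≈⊖ _ _ _)
    where
    factor = λ v h → (if v then β t else x (F i j)) + (if h then - α j else 0#)
    vertical = ≡.trans (eqAt≡linked t j ij) (linked-sym i j t j)
    horizontal = eqAt≡linked i (suc j) ij

  markingSumR≈factorR : ∀ i k → T (isCell i (suc k)) → markingSumR (i , suc k) ≈ factorR i k
  markingSumR≈factorR i k ik =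
    trans (reflexive (≡.cong₂ factor vertical horizontal)) (+-if≈⊖ _ _ _)
    where
    factor = λ v h → (if v then β i else x (F i (suc k))) + (if h then - α k else 0#)
    vertical = eqAt≡linked (suc i) (suc k) ik
    horizontal = ≡.trans (eqAt≡linked i k ik) (linked-sym i (suc k) i k)

  rowL rowR row₀ : ℕ → Carrier
  rowL i = ∏[ k < width ] when (isCell i (suc k)) (factorL i (suc k))
  rowR i = ∏[ k < width ] when (isCell i (suc k)) (factorR i k)
  row₀ i = ∏[ k < width ] when (isCell i (suc k)) (factor₀ i k)

  two-rows : ∀ t → row₀ t * rowL (suc t) ≈ rowR t * row₀ (suc t)
  two-rows t = begin
    row₀ t * rowL (suc t)  ≈⟨ prod-* width _ _ ⟨
    prod width l           ≈⟨ *-identityʳ _ ⟨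
    prod width l * 1#      ≈⟨ *-congˡ (when-¬T _ closed) ⟨
    prod width l * p width ≈⟨ carry-sweep l r p q refl step width ⟩
    prod width r * q width ≈⟨ *-congˡ (when-¬T _ closed) ⟩
    prod width r * 1#      ≈⟨ *-identityʳ _ ⟩
    prod width r           ≈⟨ prod-* width _ _ ⟩
    rowR t * row₀ (suc t)  ∎
    where
    b = suc t
    l = λ k → when (isCell t (suc k)) (factor₀ t k) * when (isCell b (suc k)) (factorL b (suc k))
    r = λ k → when (isCell t (suc k)) (factorR t k) * when (isCell b (suc k)) (factor₀ b k)
    p = λ k → when (hLink b k) (if vLink t k then β t else x (F b k))
    q = λ k → when (hLink b k) ((if vLink t k then β t else x (F b k)) - α k)
    closed : ¬ T (hLink b width)
    closed h = isCell-beyond-width b (proj₁ (proj₂ (linked⇒ {b} {width} h)))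
    step : ∀ k → CarryStep (p k) (q k) (l k) (r k) (p (suc k)) (q (suc k))
    step k = carry-step
               (isCell t c) (isCell b c) (hLink t k) (hLink b k) (hLink b c) (vLink t c) (vLink t k)
               (x (F t c)) (x (F b c)) (x (F b k)) (β t) (α k) (α c)
               (λ v → let tc , bc , _ = linked⇒ {t} {c} v in tc , bc)
               (λ h → proj₁ (proj₂ (linked⇒ {b} {k} h)))
               (λ h → proj₁ (linked⇒ {b} {c} h))
               (λ v → ≡.cong x (proj₂ (proj₂ (linked⇒ {t} {c} v))))
               (λ h → ≡.cong x (proj₂ (proj₂ (linked⇒ {b} {k} h))))
               (square-top-right t k) (square-left-bottom t k)
      where c = suc k

  rows-telescope : ∏[ r < length λ' ] rowL (suc r) ≈ ∏[ r < length λ' ] rowR (suc r)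
  rows-telescope = begin
    prod n (rowL ∘ suc)          ≈⟨ *-identityˡ _ ⟨
    1# * prod n (rowL ∘ suc)     ≈⟨ *-congʳ row₀-zero ⟨
    row₀ 0 * prod n (rowL ∘ suc) ≈⟨ telescope row₀ (rowL ∘ suc) rowR two-rows n ⟩
    prod n rowR * row₀ n         ≈⟨ *-congˡ row₀-last≈rowR ⟩
    prod (suc n) rowR            ≈⟨ prod-suc n rowR ⟩
    rowR 0 * prod n (rowR ∘ suc) ≈⟨ *-congʳ rowR-zero ⟩
    1# * prod n (rowR ∘ suc)     ≈⟨ *-identityˡ _ ⟩
    prod n (rowR ∘ suc)          ∎
    where
    n = length λ'
    row₀-zero : row₀ 0 ≈ 1#
    row₀-zero = prod-trivial width (λ _ _ → refl)
    rowR-zero : rowR 0 ≈ 1#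
    rowR-zero = prod-trivial width (λ _ _ → refl)
    no-vLink-last : ∀ k → vLink n (suc k) ≡ false
    no-vLink-last k =
      ≡.trans (≡.cong (λ b → isCell n (suc k) ∧ (b ∧ _)) (isCell-below-last k)) (∧-zeroʳ _)
    row₀-last≈rowR : row₀ n ≈ rowR n
    row₀-last≈rowR = prod-cong width λ k _ → when-cong (isCell n (suc k)) λ _ → reflexive
      (≡.cong (λ v → (if v then β n else x (F n (suc k))) ⊖⟨ hLink n k ⟩ α k)
              (≡.sym (no-vLink-last k)))

  sumMRPP≈rowsL : sumMRPP x α β λ' μ F ≈ ∏[ r < length λ' ] rowL (suc r)
  sumMRPP≈rowsL = begin
    sumMRPP x α β λ' μ F
      ≈⟨ sumL-markings (wL x α β λ' μ F) (leftMarkable λ' μ F) (cells λ' μ) ⟩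
    prodL (map markingSumL (cells λ' μ))
      ≈⟨ prodL-cells markingSumL ⟩
    ∏[ r < length λ' ] ∏[ k < width ] when (isCell (suc r) (suc k)) (markingSumL (suc r , suc k))
      ≈⟨ prod-cong (length λ') (λ r _ → prod-cong width λ k _ →
           when-cong (isCell (suc r) (suc k)) (markingSumL≈factorL (suc r) (suc k))) ⟩
    ∏[ r < length λ' ] rowL (suc r) ∎

  sumRMRPP≈rowsR : sumRMRPP x α β λ' μ F ≈ ∏[ r < length λ' ] rowR (suc r)
  sumRMRPP≈rowsR = begin
    sumRMRPP x α β λ' μ F
      ≈⟨ sumL-markings (wR x α β λ' μ F) (rightMarkable λ' μ F) (cells λ' μ) ⟩
    prodL (map markingSumR (cells λ' μ))
      ≈⟨ prodL-cells markingSumR ⟩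
    ∏[ r < length λ' ] ∏[ k < width ] when (isCell (suc r) (suc k)) (markingSumR (suc r , suc k))
      ≈⟨ prod-cong (length λ') (λ r _ → prod-cong width λ k _ →
           when-cong (isCell (suc r) (suc k)) (markingSumR≈factorR (suc r) k)) ⟩
    ∏[ r < length λ' ] rowR (suc r) ∎

proposition4p22 : {c ℓ : Level} (R : CommutativeRing c ℓ)
    (x α β : ℕ → CommutativeRing.Carrier R)
    (λ' μ : List ℕ) → IsPartition λ' → IsPartition μ → μ ⊆ₚ λ' →
    (T₀ : Filling) → IsRPP λ' μ T₀ →
    CommutativeRing._≈_ R (Weights.sumMRPP R x α β λ' μ T₀)
                          (Weights.sumRMRPP R x α β λ' μ T₀)
proposition4p22 R x α β λ' μ pλ pμ μ⊆λ T₀ rpp = begin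
  Weights.sumMRPP R x α β λ' μ T₀    ≈⟨ sumMRPP≈rowsL ⟩
  ∏[ r < length λ' ] rowL (suc r)    ≈⟨ rows-telescope ⟩
  ∏[ r < length λ' ] rowR (suc r)    ≈⟨ sumRMRPP≈rowsR ⟨
  Weights.sumRMRPP R x α β λ' μ T₀   ∎
  where
  open CommutativeRing R using (setoid)
  open import Relation.Binary.Reasoning.Setoid setoid
  open RingProducts R using (prod)
  open Tableau R x α β λ' μ pλ pμ μ⊆λ T₀ rpp
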